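{- For every $n\ge1$, the number of arithmetical structures on the fan graph $F_n$ satisfies $|\mathrm{Arith}(F_n)|\ge 10^n$.
   Context: The fan graph $F_n$ has vertices $v_0,\dots,v_{2n}$, with edges $v_0v_i$ for $1\le i\le 2n$ and $v_{2j-1}v_{2j}$ for $1\le j\le n$. For a finite connected graph $G$ with adjacency matrix $A$, an arithmetical structure on $G$ is a pair $(\mathbf d,\mathbf r)$ of vectors of positive integers indexed by the vertices such that $\mathbf r$ is primitive (gcd of entries equal to $1$) and $(\mathrm{diag}(\mathbf d)-A)\mathbf r=0$; $\mathrm{Arith}(G)$ denotes the set of all arithmetical structures on $G$. -}

module Defs where

open import Data.Nat using (ℕ; zero; suc; _+_; _*_; _≤_; _<_; _≡ᵇ_)
open import Data.Nat.GCD using (gcd)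
open import Data.Bool using (Bool; true; false; if_then_else_; _∧_; _∨_; not)
open import Data.Fin using (Fin; toℕ)
open import Data.Vec using (Vec; lookup; tabulate; foldr; sum)
open import Data.Product using (Σ; _×_; _,_; proj₁)
open import Relation.Binary.PropositionalEquality using (_≡_)

AdjMatrix : ℕ → Set
AdjMatrix m = Fin m → Fin m → ℕ

gcdVec : ∀ {m} → Vec ℕ m → ℕ
gcdVec = foldr _ gcd 0

matVec : ∀ {m} → AdjMatrix m → Vec ℕ m → Fin m → ℕ
matVec {m} A r v = sum (tabulate {n = m} (λ u → A v u * lookup r u))

-- (d, r) is an arithmetical structure on the graph with adjacency matrix A:
-- d, r have positive entries, r is primitive, and (diag(d) - A) r = 0,
-- i.e. d_v * r_v = (A r)_v for every vertex v.
IsArith : ∀ {m} → AdjMatrix m → Vec ℕ m → Vec ℕ m → Set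
IsArith {m} A d r =
  (∀ v → 0 < lookup d v) ×
  (∀ v → 0 < lookup r v) ×
  (gcdVec r ≡ 1) ×
  (∀ v → lookup d v * lookup r v ≡ matVec A r v)

Arith : ∀ {m} → AdjMatrix m → Set
Arith {m} A = Σ (Vec ℕ m × Vec ℕ m) (λ dr → IsArith A (proj₁ dr) (Data.Product.proj₂ dr))

odd : ℕ → Bool
odd zero = false
odd (suc n) = not (odd n)

-- adjacency in the fan F_n on vertices v_0, …, v_{2n} (indices as naturals):
-- v_0 ~ v_i for i ≥ 1, and v_{2j-1} ~ v_{2j}.
fanAdjℕ : ℕ → ℕ → Bool
fanAdjℕ zero zero = false
fanAdjℕ zero (suc _) = true
fanAdjℕ (suc _) zero = true
fanAdjℕ i j = (odd i ∧ (j ≡ᵇ suc i)) ∨ (odd j ∧ (i ≡ᵇ suc j))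

fan : (n : ℕ) → AdjMatrix (suc (2 * n))
fan n i j = if fanAdjℕ (toℕ i) (toℕ j) then 1 else 0

-- Fix r(v₀) = c. The conditions at the two leaves of a blade v₀ v₂ⱼ₋₁ v₂ⱼ then involve
-- that blade only: d₁ r₁ = c + r₂ and d₂ r₂ = c + r₁. The condition at v₀ reads
-- d₀ c = Σ (r₁ + r₂), which holds with d₀ = Σ (r₁ + r₂) / c once c ∣ r₁ + r₂ on every blade.
-- For c = 6 there are ten such blades, with pairwise distinct (d₁, d₂), to be chosen
-- independently on the n blades. Dividing r by the gcd of its entries keeps d, so the
-- 10ⁿ choices give arithmetical structures with pairwise distinct d.

{-# OPTIONS --safe #-}
module Submission where

open import Defs
open import Data.Nat using (ℕ; suc; _^_; _≤_)
open import Data.Fin using (Fin)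
open import Data.Product using (Σ; proj₁)
open import Relation.Binary.PropositionalEquality using (_≡_)

open import Data.Bool using (Bool; true; false; if_then_else_; _∧_; _∨_)
open import Data.Bool.Properties using (∧-zeroʳ; not-involutive)
open import Data.Nat using (_≡ᵇ_; zero; _+_; _*_; _<_; z<s; s<s; s<s⁻¹; NonZero; ≢-nonZero; >-nonZero⁻¹)
open import Data.Nat.Properties
open import Algebra.Properties.CommutativeSemigroup *-commutativeSemigroup using (x∙yz≈y∙xz)
open import Data.Nat.GCD using (gcd; gcd[m,n]∣m; gcd[m,n]∣n; gcd[m,n]≢0; c*gcd[m,n]≡gcd[cm,cn])
open import Data.Nat.Divisibility using (_∣_; ∣-trans)
open import Data.Nat.DivMod using (_/_; m*[n/m]≡n)
open import Data.Fin using (toℕ; fromℕ<; finToFun; funToFin; combine) renaming (zero to fzero; suc to fsuc)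
open import Data.Fin.Properties using (toℕ<n; toℕ-fromℕ<; funToFin-finToFin; all?) renaming (_≟_ to _≟ᶠ_)
open import Data.Vec using (Vec; []; _∷_; lookup; tabulate; map)
import Data.Vec as Vec
open import Data.Vec.Properties using (lookup∘tabulate; lookup-map)
import Data.Vec.Functional as Vector
open import Data.Product using (Σ-syntax; _×_; _,_; proj₂)
import Data.Product.Properties as Product
open import Data.Sum using (inj₁)
open import Data.Unit using (tt)
open import Function using (_∘_)
open import Function.Definitions using (Injective)
open import Relation.Binary.PropositionalEquality using (_≗_; refl; sym; trans; cong; cong₂; subst; module ≡-Reasoning)
open import Relation.Nullary.Decidable using (Dec; toWitness; _→-dec_)

open import Algebra.Properties.Semiring.Sum +-*-semiring
  using (sum; sum-cong-≗; *-distribˡ-sum; sum-replicate-zero)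

m*n>0⇒m>0 : ∀ m n → 0 < m * n → 0 < m
m*n>0⇒m>0 (suc m) n _ = z<s

m*n>0⇒n>0 : ∀ m n → 0 < m * n → 0 < n
m*n>0⇒n>0 m n mn>0 = m*n>0⇒m>0 n m (subst (0 <_) (*-comm m n) mn>0)

sum-tabulate : ∀ {m} (f : Fin m → ℕ) → Vec.sum (tabulate f) ≡ sum f
sum-tabulate {zero}  f = refl
sum-tabulate {suc m} f = cong (f fzero +_) (sum-tabulate (f ∘ fsuc))

matVec-tabulate : ∀ {m} (A : AdjMatrix m) (f : Fin m → ℕ) v →
                  matVec A (tabulate f) v ≡ sum (λ u → A v u * f u)
matVec-tabulate A f v = begin
  Vec.sum (tabulate (λ u → A v u * lookup (tabulate f) u))
    ≡⟨ sum-tabulate (λ u → A v u * lookup (tabulate f) u) ⟩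
  sum (λ u → A v u * lookup (tabulate f) u)
    ≡⟨ sum-cong-≗ (λ u → cong (A v u *_) (lookup∘tabulate f u)) ⟩
  sum (λ u → A v u * f u) ∎
  where open ≡-Reasoning

matVec-map-* : ∀ {m} (A : AdjMatrix m) g (r : Vec ℕ m) v →
               matVec A (map (g *_) r) v ≡ g * matVec A r v
matVec-map-* A g r v = begin
  Vec.sum (tabulate (λ u → A v u * lookup (map (g *_) r) u))
    ≡⟨ sum-tabulate (λ u → A v u * lookup (map (g *_) r) u) ⟩
  sum (λ u → A v u * lookup (map (g *_) r) u)
    ≡⟨ sum-cong-≗ (λ u → trans (cong (A v u *_) (lookup-map u (g *_) r))
                               (x∙yz≈y∙xz (A v u) g (lookup r u))) ⟩
  sum (λ u → g * (A v u * lookup r u))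
    ≡⟨ *-distribˡ-sum g (λ u → A v u * lookup r u) ⟨
  g * sum (λ u → A v u * lookup r u)
    ≡⟨ cong (g *_) (sum-tabulate (λ u → A v u * lookup r u)) ⟨
  g * matVec A r v ∎
  where open ≡-Reasoning

tabulate-injective : ∀ {A : Set} {m} {f g : Fin m → A} → tabulate f ≡ tabulate g → f ≗ g
tabulate-injective {f = f} {g} eq i =
  trans (sym (lookup∘tabulate f i)) (trans (cong (λ v → lookup v i) eq) (lookup∘tabulate g i))

tabulate>0 : ∀ {m} (f : Fin m → ℕ) → (∀ v → 0 < f v) → ∀ v → 0 < lookup (tabulate f) v
tabulate>0 f f>0 v = subst (0 <_) (sym (lookup∘tabulate f v)) (f>0 v)

gcdVec-∣ : ∀ {m} (r : Vec ℕ m) v → gcdVec r ∣ lookup r v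
gcdVec-∣ (x ∷ r) fzero    = gcd[m,n]∣m x (gcdVec r)
gcdVec-∣ (x ∷ r) (fsuc v) = ∣-trans (gcd[m,n]∣n x (gcdVec r)) (gcdVec-∣ r v)

gcdVec≢0 : ∀ {m} (r : Vec ℕ (suc m)) → 0 < lookup r fzero → NonZero (gcdVec r)
gcdVec≢0 (x ∷ r) x>0 = ≢-nonZero (gcd[m,n]≢0 x (gcdVec r) (inj₁ (n>0⇒n≢0 x>0)))

gcdVec-map-* : ∀ {m} g (r : Vec ℕ m) → gcdVec (map (g *_) r) ≡ g * gcdVec r
gcdVec-map-* g []      = sym (*-zeroʳ g)
gcdVec-map-* g (x ∷ r) = trans (cong (gcd (g * x)) (gcdVec-map-* g r))
                               (sym (c*gcd[m,n]≡gcd[cm,cn] g x (gcdVec r)))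

map-*-/ : ∀ {k} g .{{_ : NonZero g}} (xs : Vec ℕ k) → (∀ v → g ∣ lookup xs v) →
          map (g *_) (map (_/ g) xs) ≡ xs
map-*-/ g []       g∣xs = refl
map-*-/ g (x ∷ xs) g∣xs = cong₂ _∷_ (m*[n/m]≡n (g∣xs fzero)) (map-*-/ g xs (g∣xs ∘ fsuc))

Solves : ∀ {m} → AdjMatrix m → Vec ℕ m → Vec ℕ m → Set
Solves A d r = ∀ v → lookup d v * lookup r v ≡ matVec A r v

Solves-map-*⁻¹ : ∀ {m} (A : AdjMatrix m) d r g .{{_ : NonZero g}} →
                 Solves A d (map (g *_) r) → Solves A d r
Solves-map-*⁻¹ A d r g solves v = *-cancelˡ-≡ _ _ g (begin
  g * (lookup d v * lookup r v)        ≡⟨ x∙yz≈y∙xz g (lookup d v) (lookup r v) ⟩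
  lookup d v * (g * lookup r v)        ≡⟨ cong (lookup d v *_) (lookup-map v (g *_) r) ⟨
  lookup d v * lookup (map (g *_) r) v ≡⟨ solves v ⟩
  matVec A (map (g *_) r) v            ≡⟨ matVec-map-* A g r v ⟩
  g * matVec A r v                     ∎)
  where open ≡-Reasoning

module _ {m} (R : Vec ℕ (suc m)) (R>0 : ∀ v → 0 < lookup R v) where

  private
    g : ℕ
    g = gcdVec R

    instance
      g≢0 : NonZero g
      g≢0 = gcdVec≢0 R (R>0 fzero)

  primitivePart : Vec ℕ (suc m)
  primitivePart = map (_/ g) R

  primitivePart-scale : map (g *_) primitivePart ≡ R
  primitivePart-scale = map-*-/ g R (gcdVec-∣ R)

  lookup-primitivePart : ∀ v → g * lookup primitivePart v ≡ lookup R v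
  lookup-primitivePart v = trans (sym (lookup-map v (g *_) primitivePart))
                                 (cong (λ r → lookup r v) primitivePart-scale)

  primitivePart>0 : ∀ v → 0 < lookup primitivePart v
  primitivePart>0 v = m*n>0⇒n>0 g _ (subst (0 <_) (sym (lookup-primitivePart v)) (R>0 v))

  gcdVec-primitivePart : gcdVec primitivePart ≡ 1
  gcdVec-primitivePart = *-cancelˡ-≡ _ 1 g (begin
    g * gcdVec primitivePart          ≡⟨ gcdVec-map-* g primitivePart ⟨
    gcdVec (map (g *_) primitivePart) ≡⟨ cong gcdVec primitivePart-scale ⟩
    g                                 ≡⟨ *-identityʳ g ⟨
    g * 1                             ∎)
    where open ≡-Reasoning

  Solves-primitivePart : ∀ (A : AdjMatrix (suc m)) d → Solves A d R → Solves A d primitivePart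
  Solves-primitivePart A d solves =
    Solves-map-*⁻¹ A d primitivePart g (subst (Solves A d) (sym primitivePart-scale) solves)

Solves⇒IsArith : ∀ {m} (A : AdjMatrix (suc m)) d R →
                 (∀ v → 0 < lookup d v) → (∀ v → 0 < lookup R v) → Solves A d R →
                 Σ[ r ∈ Vec ℕ (suc m) ] IsArith A d r
Solves⇒IsArith A d R d>0 R>0 solves =
  primitivePart R R>0 , d>0 , primitivePart>0 R R>0 , gcdVec-primitivePart R R>0 ,
  Solves-primitivePart R R>0 A d solves

funToFin-cong : ∀ {m n} {f g : Fin m → Fin n} → f ≗ g → funToFin f ≡ funToFin g
funToFin-cong {zero}  f≗g = refl
funToFin-cong {suc m} f≗g = cong₂ combine (f≗g fzero) (funToFin-cong (f≗g ∘ fsuc))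

finToFun-injective : ∀ {m n} {i j : Fin (m ^ n)} → finToFun {m} {n} i ≗ finToFun j → i ≡ j
finToFun-injective {m} {n} {i} {j} eq =
  trans (sym (funToFin-finToFin {n} {m} i)) (trans (funToFin-cong eq) (funToFin-finToFin {n} {m} j))

sumBelow : ℕ → (ℕ → ℕ) → ℕ
sumBelow m h = sum {m} (h ∘ toℕ)

sumBelow-cong : ∀ m {h h′} → h ≗ h′ → sumBelow m h ≡ sumBelow m h′
sumBelow-cong m {h} {h′} h≗h′ = sum-cong-≗ {m} {h ∘ toℕ} {h′ ∘ toℕ} (h≗h′ ∘ toℕ)

sumBelow-sole : ∀ m x → 1 * x + sumBelow m (λ _ → 0) ≡ x
sumBelow-sole m x = trans (cong₂ _+_ (*-identityˡ x) (sum-replicate-zero m)) (+-identityʳ x)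

sumBelow-2*suc : ∀ n h → sumBelow (2 * suc n) h ≡ h 0 + (h 1 + sumBelow (2 * n) (h ∘ suc ∘ suc))
sumBelow-2*suc n h = cong (λ m → sumBelow m h) (*-suc 2 n)

<2*suc : ∀ n {k} → k < suc (suc (2 * n)) → k < 2 * suc n
<2*suc n {k} = subst (k <_) (sym (*-suc 2 n))

<2*suc⁻¹ : ∀ n {k} → suc (suc k) < 2 * suc n → k < 2 * n
<2*suc⁻¹ n {k} k+2<2n+2 = s<s⁻¹ (s<s⁻¹ (subst (suc (suc k) <_) (*-suc 2 n) k+2<2n+2))

indicator : Bool → ℕ
indicator b = if b then 1 else 0

matched : ℕ → ℕ → Bool
matched 0 1 = true
matched 1 0 = true
matched (suc (suc k)) (suc (suc u)) = matched k u
matched _ _ = false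

fanAdjℕ-suc-suc : ∀ k u → fanAdjℕ (suc k) (suc u) ≡ matched k u
fanAdjℕ-suc-suc 0 0 = refl
fanAdjℕ-suc-suc 0 1 = refl
fanAdjℕ-suc-suc 0 (suc (suc u)) = ∧-zeroʳ _
fanAdjℕ-suc-suc 1 0 = refl
fanAdjℕ-suc-suc 1 1 = refl
fanAdjℕ-suc-suc 1 (suc (suc u)) = ∧-zeroʳ _
fanAdjℕ-suc-suc (suc (suc k)) 0 = cong (_∨ false) (∧-zeroʳ _)
fanAdjℕ-suc-suc (suc (suc k)) 1 = cong (_∨ false) (∧-zeroʳ _)
fanAdjℕ-suc-suc (suc (suc k)) (suc (suc u)) = begin
  fanAdjℕ (3 + k) (3 + u)
    ≡⟨ cong₂ (λ p q → (p ∧ (u ≡ᵇ suc k)) ∨ (q ∧ (k ≡ᵇ suc u)))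
             (not-involutive (odd (suc k))) (not-involutive (odd (suc u))) ⟩
  fanAdjℕ (suc k) (suc u)
    ≡⟨ fanAdjℕ-suc-suc k u ⟩
  matched k u ∎
  where open ≡-Reasoning

-- Leaf k is the vertex vₖ₊₁, so blade j holds leaves 2j and 2j + 1. Past the last leaf the
-- value is 1, which makes leaves>0 hold at every index.
leaves : ∀ {n} → (Fin n → ℕ × ℕ) → ℕ → ℕ
leaves {zero}  p k             = 1
leaves {suc n} p 0             = proj₁ (p fzero)
leaves {suc n} p 1             = proj₂ (p fzero)
leaves {suc n} p (suc (suc k)) = leaves (p ∘ fsuc) k

Positive² : ℕ × ℕ → Set
Positive² (x , y) = 0 < x × 0 < y

leaves>0 : ∀ {n} (p : Fin n → ℕ × ℕ) → (∀ j → Positive² (p j)) → ∀ k → 0 < leaves p k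
leaves>0 {zero}  p p>0 k             = z<s
leaves>0 {suc n} p p>0 0             = proj₁ (p>0 fzero)
leaves>0 {suc n} p p>0 1             = proj₂ (p>0 fzero)
leaves>0 {suc n} p p>0 (suc (suc k)) = leaves>0 (p ∘ fsuc) (p>0 ∘ fsuc) k

leaves-injective : ∀ {n} (p q : Fin n → ℕ × ℕ) →
                   (∀ k → k < 2 * n → leaves p k ≡ leaves q k) → p ≗ q
leaves-injective {suc n} p q p≡q fzero =
  cong₂ _,_ (p≡q 0 (<2*suc n z<s)) (p≡q 1 (<2*suc n (s<s z<s)))
leaves-injective {suc n} p q p≡q (fsuc j) =
  leaves-injective (p ∘ fsuc) (q ∘ fsuc)
    (λ k k<2n → p≡q (suc (suc k)) (<2*suc n (s<s (s<s k<2n)))) j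

-- The labels of a blade v₀ v₂ⱼ₋₁ v₂ⱼ when r(v₀) = c; share is its contribution to d(v₀).
record Blade (c : ℕ) : Set where
  constructor blade
  field
    r₁ r₂ d₁ d₂ share : ℕ
    balance₁ : d₁ * r₁ ≡ c + r₂
    balance₂ : d₂ * r₂ ≡ c + r₁
    balance₀ : share * c ≡ r₁ + r₂

  rPair dPair : ℕ × ℕ
  rPair = r₁ , r₂
  dPair = d₁ , d₂

open Blade

module _ {c : ℕ} where

  apexD : ∀ {n} → (Fin n → Blade c) → ℕ
  apexD bs = sum (share ∘ bs)

  fanR fanD : ∀ {n} → (Fin n → Blade c) → Fin (suc (2 * n)) → ℕ
  fanR bs = c Vector.∷ (leaves (rPair ∘ bs) ∘ toℕ)
  fanD bs = apexD bs Vector.∷ (leaves (dPair ∘ bs) ∘ toℕ)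

  leaves-sum : ∀ {n} (bs : Fin n → Blade c) →
               sumBelow (2 * n) (leaves (rPair ∘ bs)) ≡ apexD bs * c
  leaves-sum {zero}  bs = refl
  leaves-sum {suc n} bs = begin
    sumBelow (2 * suc n) (leaves (rPair ∘ bs))
      ≡⟨ sumBelow-2*suc n (leaves (rPair ∘ bs)) ⟩
    r₁ b + (r₂ b + sumBelow (2 * n) (leaves (rPair ∘ bs ∘ fsuc)))
      ≡⟨ +-assoc (r₁ b) (r₂ b) _ ⟨
    (r₁ b + r₂ b) + sumBelow (2 * n) (leaves (rPair ∘ bs ∘ fsuc))
      ≡⟨ cong₂ _+_ (sym (balance₀ b)) (leaves-sum (bs ∘ fsuc)) ⟩
    share b * c + apexD (bs ∘ fsuc) * c
      ≡⟨ *-distribʳ-+ c (share b) (apexD (bs ∘ fsuc)) ⟨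
    apexD bs * c ∎
    where
    open ≡-Reasoning
    b = bs fzero

  rimTerm : ∀ {n} → (Fin n → Blade c) → ℕ → ℕ → ℕ
  rimTerm bs k u = indicator (matched k u) * leaves (rPair ∘ bs) u

  leaf-balance : ∀ {n} (bs : Fin n → Blade c) k → k < 2 * n →
                 leaves (dPair ∘ bs) k * leaves (rPair ∘ bs) k
                   ≡ c + sumBelow (2 * n) (rimTerm bs k)
  leaf-balance {suc n} bs 0 _ = trans (balance₁ (bs fzero)) (cong (c +_) (sym
    (trans (sumBelow-2*suc n (rimTerm bs 0)) (sumBelow-sole (2 * n) _))))
  leaf-balance {suc n} bs 1 _ = trans (balance₂ (bs fzero)) (cong (c +_) (sym
    (trans (sumBelow-2*suc n (rimTerm bs 1)) (sumBelow-sole (2 * n) _))))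
  leaf-balance {suc n} bs (suc (suc k)) k+2<2n+2 =
    trans (leaf-balance (bs ∘ fsuc) k (<2*suc⁻¹ n k+2<2n+2))
          (cong (c +_) (sym (sumBelow-2*suc n (rimTerm bs (suc (suc k))))))

  vertex-balance : ∀ {n} (bs : Fin n → Blade c) v →
                   fanD bs v * fanR bs v ≡ sum (λ u → fan n v u * fanR bs u)
  vertex-balance {n} bs fzero = begin
    apexD bs * c
      ≡⟨ leaves-sum bs ⟨
    sumBelow (2 * n) (leaves (rPair ∘ bs))
      ≡⟨ sumBelow-cong (2 * n) (*-identityˡ ∘ leaves (rPair ∘ bs)) ⟨
    sumBelow (2 * n) (λ u → 1 * leaves (rPair ∘ bs) u) ∎
    where open ≡-Reasoning
  vertex-balance {n} bs (fsuc w) = begin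
    leaves (dPair ∘ bs) k * leaves (rPair ∘ bs) k
      ≡⟨ leaf-balance bs k (toℕ<n w) ⟩
    c + sumBelow (2 * n) (rimTerm bs k)
      ≡⟨ cong₂ _+_ (*-identityˡ c) (sumBelow-cong (2 * n) λ u →
           cong (λ b → indicator b * leaves (rPair ∘ bs) u) (fanAdjℕ-suc-suc k u)) ⟨
    1 * c + sumBelow (2 * n) (λ u → indicator (fanAdjℕ (suc k) (suc u)) * leaves (rPair ∘ bs) u) ∎
    where
    open ≡-Reasoning
    k = toℕ w

  fan-solves : ∀ {n} (bs : Fin n → Blade c) →
               Solves (fan n) (tabulate (fanD bs)) (tabulate (fanR bs))
  fan-solves {n} bs v = begin
    lookup (tabulate (fanD bs)) v * lookup (tabulate (fanR bs)) v
      ≡⟨ cong₂ _*_ (lookup∘tabulate (fanD bs) v) (lookup∘tabulate (fanR bs) v) ⟩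
    fanD bs v * fanR bs v
      ≡⟨ vertex-balance bs v ⟩
    sum (λ u → fan n v u * fanR bs u)
      ≡⟨ matVec-tabulate (fan n) (fanR bs) v ⟨
    matVec (fan n) (tabulate (fanR bs)) v ∎
    where open ≡-Reasoning

module _ {c : ℕ} .{{_ : NonZero c}} where

  private
    c+x>0 : ∀ x → 0 < c + x
    c+x>0 x = <-≤-trans (>-nonZero⁻¹ c) (m≤m+n c x)

  rPair>0 : (b : Blade c) → Positive² (rPair b)
  rPair>0 b = m*n>0⇒n>0 (d₁ b) _ (subst (0 <_) (sym (balance₁ b)) (c+x>0 _))
            , m*n>0⇒n>0 (d₂ b) _ (subst (0 <_) (sym (balance₂ b)) (c+x>0 _))

  dPair>0 : (b : Blade c) → Positive² (dPair b)
  dPair>0 b = m*n>0⇒m>0 _ (r₁ b) (subst (0 <_) (sym (balance₁ b)) (c+x>0 _))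
            , m*n>0⇒m>0 _ (r₂ b) (subst (0 <_) (sym (balance₂ b)) (c+x>0 _))

  share>0 : (b : Blade c) → 0 < share b
  share>0 b = m*n>0⇒m>0 _ c
    (subst (0 <_) (sym (balance₀ b)) (<-≤-trans (proj₁ (rPair>0 b)) (m≤m+n _ _)))

  fanR>0 : ∀ {n} (bs : Fin n → Blade c) v → 0 < fanR bs v
  fanR>0 bs fzero    = >-nonZero⁻¹ c
  fanR>0 bs (fsuc w) = leaves>0 (rPair ∘ bs) (rPair>0 ∘ bs) (toℕ w)

  fanD>0 : ∀ {n} (bs : Fin (suc n) → Blade c) v → 0 < fanD bs v
  fanD>0 bs fzero    = <-≤-trans (share>0 (bs fzero)) (m≤m+n _ _)
  fanD>0 bs (fsuc w) = leaves>0 (dPair ∘ bs) (dPair>0 ∘ bs) (toℕ w)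

  fanStructure : ∀ {n} → (Fin (suc n) → Blade c) → Arith (fan (suc n))
  fanStructure {n} bs = (tabulate (fanD bs) , proj₁ structure) , proj₂ structure
    where
    structure : Σ[ r ∈ Vec ℕ (suc (2 * suc n)) ] IsArith (fan (suc n)) (tabulate (fanD bs)) r
    structure = Solves⇒IsArith (fan (suc n)) (tabulate (fanD bs)) (tabulate (fanR bs))
      (tabulate>0 (fanD bs) (fanD>0 bs)) (tabulate>0 (fanR bs) (fanR>0 bs)) (fan-solves bs)

  fanStructure-injective : ∀ {n} (bs bs′ : Fin (suc n) → Blade c) →
                           proj₁ (fanStructure bs) ≡ proj₁ (fanStructure bs′) →
                           dPair ∘ bs ≗ dPair ∘ bs′
  fanStructure-injective bs bs′ eq = leaves-injective (dPair ∘ bs) (dPair ∘ bs′) λ k k<2n →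
    subst (λ i → leaves (dPair ∘ bs) i ≡ leaves (dPair ∘ bs′) i) (toℕ-fromℕ< k<2n)
          (tabulate-injective {f = fanD bs} {fanD bs′} (cong proj₁ eq) (fsuc (fromℕ< k<2n)))

fanStructures : ∀ {c m} .{{_ : NonZero c}} (blades : Fin m → Blade c) →
                Injective _≡_ _≡_ (dPair ∘ blades) → ∀ n → 1 ≤ n →
                Σ (Fin (m ^ n) → Arith (fan n)) (λ f → ∀ i j → proj₁ (f i) ≡ proj₁ (f j) → i ≡ j)
fanStructures {m = m} blades inj (suc n) _ = fanStructure ∘ choose , λ i j eq →
  finToFun-injective {m} {suc n} λ w → inj (fanStructure-injective (choose i) (choose j) eq w)
  where
  choose : Fin _ → Fin (suc n) → Blade _
  choose i = blades ∘ finToFun {m} {suc n} i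

blades₆ : Vec (Blade 6) 10
blades₆ = blade  3  3 3 3 1 refl refl refl
        ∷ blade  4  2 2 5 1 refl refl refl
        ∷ blade  2  4 5 2 1 refl refl refl
        ∷ blade  9  3 1 5 2 refl refl refl
        ∷ blade  6  6 2 2 2 refl refl refl
        ∷ blade  3  9 5 1 2 refl refl refl
        ∷ blade 12  6 1 3 3 refl refl refl
        ∷ blade  6 12 3 1 3 refl refl refl
        ∷ blade 18 12 1 2 5 refl refl refl
        ∷ blade 12 18 2 1 5 refl refl refl
        ∷ []

dPair-blades₆-injective : Injective _≡_ _≡_ (dPair ∘ lookup blades₆)
dPair-blades₆-injective {i} {j} = toWitness {a? = decision} tt i j
  where
  decision : Dec (∀ i j → dPair (lookup blades₆ i) ≡ dPair (lookup blades₆ j) → i ≡ j)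
  decision = all? λ i → all? λ j →
    Product.≡-dec _≟_ _≟_ (dPair (lookup blades₆ i)) (dPair (lookup blades₆ j)) →-dec (i ≟ᶠ j)

mainTheorem8 : (n : ℕ) → 1 ≤ n →
    Σ (Fin (10 ^ n) → Arith (fan n)) (λ f → ∀ i j → proj₁ (f i) ≡ proj₁ (f j) → i ≡ j)
mainTheorem8 = fanStructures (lookup blades₆) dPair-blades₆-injective
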